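{- Let $h(x)$ be a polynomial with real coefficients and let $F_{h,n}^l(x)=\sum_{i=0}^{l}\binom{n-1-i}{i}h^{n-2i-1}(x)$ for integers $n\ge 1$ and $0\le l\le\lfloor (n-1)/2\rfloor$. Then for all integers $l\ge 0$, $n\ge 2l+2$ and $s\ge 1$, $$\sum_{i=0}^{s-1}F_{h,n+i}^{l}(x)\,h^{s-1-i}(x)=F_{h,n+s+1}^{l+1}(x)-h^{s}(x)F_{h,n+1}^{l+1}(x).$$
   Context: $h(x)$ is a polynomial with real coefficients; $h^k(x)$ denotes $(h(x))^k$. $F_{h,n}^l(x)$ are the incomplete $h(x)$-Fibonacci polynomials. -}

module Defs where

open import Level using (Level)
open import Data.Nat as ℕ using (ℕ; zero; suc; _∸_)
open import Data.Nat.Combinatorics using (_C_)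
open import Algebra.Bundles using (CommutativeRing; Semiring)
import Algebra.Definitions.RawSemiring as RS

module _ {c ℓ : Level} (R : CommutativeRing c ℓ) where
  open CommutativeRing R
  open RS (Semiring.rawSemiring semiring) using (_×_; _^_)

  sumTo : ℕ → (ℕ → Carrier) → Carrier
  sumTo zero    f = 0#
  sumTo (suc k) f = sumTo k f + f k

  incFib : Carrier → ℕ → ℕ → Carrier
  incFib h n l = sumTo (suc l) (λ i → ((n ∸ 1 ∸ i) C i) × (h ^ (n ∸ 2 ℕ.* i ∸ 1)))

  pow : Carrier → ℕ → Carrier
  pow = _^_

{-# OPTIONS --safe #-}
-- Pascal's rule applied termwise gives F_{m+2}^{l+1} = h F_{m+1}^{l+1} + F_m^l as soon as
-- m ≥ 2l+2, i.e. as long as no binomial index is truncated. Hence G_s = F_{n+s+1}^{l+1}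
-- satisfies the first-order linear recurrence G_{s+1} = h G_s + F_{n+s}^l, whose solution
-- G_s = h^s G_0 + Σ_{i<s} F_{n+i}^l h^{s-1-i} is the identity.
module Submission where

open import Level using (Level)
open import Data.List using ([]; _∷_)
open import Data.Nat as ℕ using (ℕ; zero; suc; _∸_; _≤_; _<_; s≤s)
import Data.Nat.Properties as ℕₚ
open import Data.Nat.Tactic.RingSolver using (solve)
open import Data.Nat.Combinatorics using (_C_; nCk+nC[k+1]≡[n+1]C[k+1])
open import Algebra.Bundles using (CommutativeRing; Semiring)
import Algebra.Definitions.RawSemiring as RawSemiringDefinitions
import Algebra.Properties.Semiring.Mult as SemiringMultProperties
import Algebra.Properties.Ring as RingProperties
import Algebra.Properties.CommutativeSemigroup as CommutativeSemigroupProperties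
open import Relation.Binary.PropositionalEquality as ≡ using (_≡_; refl; cong; cong₂)
import Relation.Binary.Reasoning.Setoid as SetoidReasoning
open import Defs

n+o+p≡m⇒m∸n∸o≡p : ∀ {m} n o {p} → n ℕ.+ o ℕ.+ p ≡ m → m ∸ n ∸ o ≡ p
n+o+p≡m⇒m∸n∸o≡p n o {p} refl = ≡.trans (ℕₚ.∸-+-assoc (n ℕ.+ o ℕ.+ p) n o) (ℕₚ.m+n∸m≡n (n ℕ.+ o) p)

module _ {c ℓ : Level} (R : CommutativeRing c ℓ) where
  open CommutativeRing R
  open RawSemiringDefinitions (Semiring.rawSemiring semiring) using (_×_; _^_)
  open SemiringMultProperties semiring using (×-homo-+; ×-comm-*)
  open RingProperties ring using (-‿distribʳ-*)
  module +-CS = CommutativeSemigroupProperties +-commutativeSemigroup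
  module *-CS = CommutativeSemigroupProperties *-commutativeSemigroup
  open SetoidReasoning setoid

  sumTo-termwiseRecurrence : ∀ (x : Carrier) (a b d : ℕ → Carrier) j →
    a 0 ≈ x * b 0 → (∀ i → i < j → a (suc i) ≈ x * b (suc i) + d i) →
    sumTo R (suc j) a ≈ x * sumTo R (suc j) b + sumTo R j d
  sumTo-termwiseRecurrence x a b d zero a₀ _ = begin
    0# + a 0             ≈⟨ +-identityˡ (a 0) ⟩
    a 0                  ≈⟨ a₀ ⟩
    x * b 0              ≈⟨ *-congˡ (+-identityˡ (b 0)) ⟨
    x * (0# + b 0)       ≈⟨ +-identityʳ _ ⟨
    x * (0# + b 0) + 0#  ∎
  sumTo-termwiseRecurrence x a b d (suc j) a₀ aₛ = begin
    sumTo R (suc j) a + a (suc j)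
      ≈⟨ +-cong (sumTo-termwiseRecurrence x a b d j a₀ (λ i i<j → aₛ i (ℕₚ.m<n⇒m<1+n i<j))) (aₛ j ℕₚ.≤-refl) ⟩
    (x * sumTo R (suc j) b + sumTo R j d) + (x * b (suc j) + d j)
      ≈⟨ +-CS.interchange _ _ _ _ ⟩
    (x * sumTo R (suc j) b + x * b (suc j)) + (sumTo R j d + d j)
      ≈⟨ +-congʳ (distribˡ x _ _) ⟨
    x * (sumTo R (suc j) b + b (suc j)) + (sumTo R j d + d j)
      ∎

  sumTo-linearRecurrence : ∀ (x : Carrier) (a G : ℕ → Carrier) → (∀ k → G (suc k) ≈ x * G k + a k) →
    ∀ s → sumTo R s (λ i → a i * x ^ (s ∸ 1 ∸ i)) ≈ G s - x ^ s * G 0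
  sumTo-linearRecurrence x a G step s = begin
    sumTo R s f          ≈⟨ partialSum s ℕₚ.≤-refl ⟩
    D s * x ^ (s ∸ s)    ≡⟨ cong (λ e → D s * x ^ e) (ℕₚ.n∸n≡0 s) ⟩
    D s * 1#             ≈⟨ *-identityʳ (D s) ⟩
    D s                  ∎
    where
    f : ℕ → Carrier
    f i = a i * x ^ (s ∸ 1 ∸ i)

    D : ℕ → Carrier
    D k = G k - x ^ k * G 0

    D-zero : D 0 ≈ 0#
    D-zero = trans (+-congˡ (-‿cong (*-identityˡ (G 0)))) (-‿inverseʳ (G 0))

    D-suc : ∀ k → D (suc k) ≈ x * D k + a k
    D-suc k = begin
      G (suc k) - (x * x ^ k) * G 0           ≈⟨ +-cong (step k) (-‿cong (*-assoc x (x ^ k) (G 0))) ⟩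
      (x * G k + a k) - x * (x ^ k * G 0)     ≈⟨ +-congˡ (-‿distribʳ-* x (x ^ k * G 0)) ⟩
      (x * G k + a k) + x * - (x ^ k * G 0)   ≈⟨ +-CS.xy∙z≈xz∙y _ _ _ ⟩
      (x * G k + x * - (x ^ k * G 0)) + a k   ≈⟨ +-congʳ (distribˡ x _ _) ⟨
      x * D k + a k                           ∎

    partialSum : ∀ k → k ≤ s → sumTo R k f ≈ D k * x ^ (s ∸ k)
    partialSum zero _ = sym (trans (*-congʳ D-zero) (zeroˡ (x ^ s)))
    partialSum (suc k) k<s = begin
      sumTo R k f + a k * x ^ (s ∸ 1 ∸ k)                   ≈⟨ +-congʳ (partialSum k (ℕₚ.<⇒≤ k<s)) ⟩
      D k * x ^ (s ∸ k) + a k * x ^ (s ∸ 1 ∸ k)             ≡⟨ cong₂ (λ e e′ → D k * x ^ e + a k * x ^ e′)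
                                                                     (ℕₚ.+-∸-assoc 1 k<s) (ℕₚ.∸-+-assoc s 1 k) ⟩
      D k * (x * x ^ (s ∸ suc k)) + a k * x ^ (s ∸ suc k)   ≈⟨ +-congʳ (*-CS.x∙yz≈yx∙z (D k) x _) ⟩
      (x * D k) * x ^ (s ∸ suc k) + a k * x ^ (s ∸ suc k)   ≈⟨ distribʳ _ (x * D k) (a k) ⟨
      (x * D k + a k) * x ^ (s ∸ suc k)                     ≈⟨ *-congʳ (D-suc k) ⟨
      D (suc k) * x ^ (s ∸ suc k)                           ∎

  pascal-× : ∀ p q (y z : Carrier) → (suc p C suc q) × (y * z) ≈ y * ((p C suc q) × z) + (p C q) × (y * z)
  pascal-× p q y z = begin
    (suc p C suc q) × (y * z)                     ≡⟨ cong (_× (y * z)) (nCk+nC[k+1]≡[n+1]C[k+1] p q) ⟨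
    (p C q ℕ.+ p C suc q) × (y * z)               ≈⟨ ×-homo-+ (y * z) (p C q) (p C suc q) ⟩
    (p C q) × (y * z) + (p C suc q) × (y * z)     ≈⟨ +-congˡ (×-comm-* (p C suc q) y z) ⟨
    (p C q) × (y * z) + y * ((p C suc q) × z)     ≈⟨ +-comm _ _ ⟩
    y * ((p C suc q) × z) + (p C q) × (y * z)     ∎

  module _ (h : Carrier) where

    incFibTerm : ℕ → ℕ → Carrier
    incFibTerm m i = ((m ∸ 1 ∸ i) C i) × (h ^ (m ∸ 2 ℕ.* i ∸ 1))

    incFibTerm-reindex : ∀ m i p e → 1 ℕ.+ i ℕ.+ p ≡ m → 2 ℕ.* i ℕ.+ 1 ℕ.+ e ≡ m →
      incFibTerm m i ≡ (p C i) × (h ^ e)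
    incFibTerm-reindex m i p e m≡ m≡′ = cong₂ (λ n k → (n C i) × (h ^ k)) (n+o+p≡m⇒m∸n∸o≡p 1 i m≡) (n+o+p≡m⇒m∸n∸o≡p (2 ℕ.* i) 1 m≡′)

    incFibTerm-pascal : ∀ {m i} e → 2 ℕ.* i ℕ.+ 2 ℕ.+ e ≡ m →
      incFibTerm (suc (suc m)) (suc i) ≈ h * incFibTerm (suc m) (suc i) + incFibTerm m i
    -- With m = 2i+2+e and p = i+e+1 the three binomials are C(p+1,i+1), C(p,i+1) and C(p,i).
    incFibTerm-pascal {i = i} e refl =
      let m = 2 ℕ.* i ℕ.+ 2 ℕ.+ e
          p = suc (i ℕ.+ e)
      in begin
      incFibTerm (2 ℕ.+ m) (suc i)
        ≡⟨ incFibTerm-reindex (2 ℕ.+ m) (suc i) (suc p) (suc e) (solve (i ∷ e ∷ [])) (solve (i ∷ e ∷ [])) ⟩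
      (suc p C suc i) × (h * h ^ e)
        ≈⟨ pascal-× p i h (h ^ e) ⟩
      h * ((p C suc i) × (h ^ e)) + (p C i) × (h * h ^ e)
        ≡⟨ cong₂ (λ u v → h * u + v)
             (incFibTerm-reindex (1 ℕ.+ m) (suc i) p e (solve (i ∷ e ∷ [])) (solve (i ∷ e ∷ [])))
             (incFibTerm-reindex m i p (suc e) (solve (i ∷ e ∷ [])) (solve (i ∷ e ∷ []))) ⟨
      h * incFibTerm (1 ℕ.+ m) (suc i) + incFibTerm m i
        ∎

    incFib-recurrence : ∀ {l m} → 2 ℕ.* l ℕ.+ 2 ≤ m →
      incFib R h (suc (suc m)) (suc l) ≈ h * incFib R h (suc m) (suc l) + incFib R h m l
    incFib-recurrence {l} {m} 2l+2≤m =
      sumTo-termwiseRecurrence h (incFibTerm (suc (suc m))) (incFibTerm (suc m)) (incFibTerm m) (suc l)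
        (sym (×-comm-* 1 h (h ^ m))) pascal
      where
      pascal : ∀ i → i < suc l → incFibTerm (suc (suc m)) (suc i) ≈ h * incFibTerm (suc m) (suc i) + incFibTerm m i
      pascal i (s≤s i≤l) = incFibTerm-pascal (m ∸ (2 ℕ.* i ℕ.+ 2))
        (ℕₚ.m+[n∸m]≡n (ℕₚ.≤-trans (ℕₚ.+-monoˡ-≤ 2 (ℕₚ.*-monoʳ-≤ 2 i≤l)) 2l+2≤m))

open import Data.Nat using (_+_; _*_)

proposition4 : {c ℓ : Level} (R : CommutativeRing c ℓ) (h : CommutativeRing.Carrier R) (l n s : ℕ) →
    2 * l + 2 ≤ n → 1 ≤ s →
    CommutativeRing._≈_ R
      (sumTo R s (λ i → CommutativeRing._*_ R (incFib R h (n + i) l) (pow R h (s ∸ 1 ∸ i))))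
      (CommutativeRing._-_ R (incFib R h (n + s + 1) (l + 1)) (CommutativeRing._*_ R (pow R h s) (incFib R h (n + 1) (l + 1))))
proposition4 R h l n s 2l+2≤n _ =
  Ring.trans (sumTo-linearRecurrence R h (λ k → incFib R h (n + k) l) G step s)
             (Ring.reflexive (cong (λ m → G s Ring.- pow R h s Ring.* incFib R h (m + 1) (l + 1)) (ℕₚ.+-identityʳ n)))
  where
  module Ring = CommutativeRing R

  G : ℕ → Ring.Carrier
  G k = incFib R h (n + k + 1) (l + 1)

  step : ∀ k → G (suc k) Ring.≈ h Ring.* G k Ring.+ incFib R h (n + k) l
  step k rewrite ℕₚ.+-comm l 1 | ℕₚ.+-comm (n + suc k) 1 | ℕₚ.+-suc n k | ℕₚ.+-comm (n + k) 1 =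
    incFib-recurrence R h (ℕₚ.≤-trans 2l+2≤n (ℕₚ.m≤m+n n k))
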